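{- Let $T$ be a string of length $n$ and $1 \le i \le j < n$. Let $k = |\mathit{lrs}_{i,j+1}|$ and $\alpha = T[j+1]$. Then $[j+1-k, j+1] \in \mathsf{MUS}(T[i..j+1])$ if and only if $T[j+1-k..j+1] = \alpha^{k+1}$ or $k \le |\mathit{lrs}_{i,j}|$.
   Context: For a string $W$, $W[a..b]$ is the substring from position $a$ to position $b$ (empty if $a>b$). For strings $w,W$, $\#\mathit{occ}_W(w)$ is the number of positions at which $w$ occurs in $W$, with $\#\mathit{occ}_W(\varepsilon)=|W|+1$. A substring $w$ of $W$ is unique in $W$ if $\#\mathit{occ}_W(w)=1$ and repeating if $\#\mathit{occ}_W(w)\ge 2$. For $1\le i\le j\le n$, $\mathsf{MUS}(T[i..j])$ is the set of intervals $[s,t]$ with $i\le s\le t\le j$ (positions refer to $T$) such that $T[s..t]$ is unique in $T[i..j]$ and both $T[s+1..t]$ and $T[s..t-1]$ are repeating in $T[i..j]$. $\mathit{lrs}_{i,j}$ is the longest suffix of $T[i..j]$ that is repeating in $T[i..j]$ (possibly empty). $\alpha^{m}$ denotes $m$ copies of the character $\alpha$. -}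

module Defs where

open import Data.Nat using (ℕ; zero; suc; _+_; _∸_; _≤_; _<_)
open import Data.Product using (Σ; ∃; _×_; _,_)
open import Relation.Binary.PropositionalEquality using (_≡_; _≢_)

-- A string T of length n over an alphabet A is represented by the function
-- T : ℕ → A, read at the 1-based positions 1 .. n (other values are never
-- inspected by the definitions below as long as the window lies in 1 .. n).
--
-- A substring of T is given by its start position s and its length ℓ,
-- i.e. T[s .. s+ℓ-1] (empty when ℓ = 0).

-- The substring (s , ℓ) occurs in the window T[i..j] at position p.
-- (For ℓ = 0 this gives the j-i+2 = |W|+1 positions i .. j+1.)
OccursAt : {A : Set} → (ℕ → A) → (i j : ℕ) → (s ℓ : ℕ) → (p : ℕ) → Set
OccursAt T i j s ℓ p =
  (i ≤ p) × (p + ℓ ≤ suc j) × ((q : ℕ) → q < ℓ → T (p + q) ≡ T (s + q))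

Unique : {A : Set} → (ℕ → A) → (i j : ℕ) → (s ℓ : ℕ) → Set
Unique T i j s ℓ =
  Σ ℕ λ p → OccursAt T i j s ℓ p × ((p' : ℕ) → OccursAt T i j s ℓ p' → p' ≡ p)

Repeating : {A : Set} → (ℕ → A) → (i j : ℕ) → (s ℓ : ℕ) → Set
Repeating T i j s ℓ =
  Σ ℕ λ p → Σ ℕ λ p' → p ≢ p' × OccursAt T i j s ℓ p × OccursAt T i j s ℓ p'

InMUS : {A : Set} → (ℕ → A) → (i j : ℕ) → (s t : ℕ) → Set
InMUS T i j s t =
  (i ≤ s) × (s ≤ t) × (t ≤ j)
  × Unique T i j s (suc t ∸ s)
  × Repeating T i (j) (suc s) (t ∸ s)
  × Repeating T i j s (t ∸ s)

IsLrsLength : {A : Set} → (ℕ → A) → (i j : ℕ) → (k : ℕ) → Set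
IsLrsLength T i j k =
  (k ≤ suc j ∸ i)
  × Repeating T i j (suc j ∸ k) k
  × ((k' : ℕ) → k' ≤ suc j ∸ i → Repeating T i j (suc j ∸ k') k' → k' ≤ k)

-- Write s = j+1-k. The suffix T[s+1..j+1] is the lrs, and T[s..j+1], one
-- character longer, is unique by maximality of k; so the MUS condition reduces
-- to T[s..j] being repeating in T[i..j+1]. Either two of its occurrences lie
-- inside T[i..j], and then, being a suffix of T[i..j], it has length
-- k ≤ |lrs_{i,j}|; or one occurrence ends at j+1, i.e. starts at s+1, and a
-- string equal to its own shift by one is a run α^(k+1). Conversely a run
-- occurs at s and s+1, and for k ≤ |lrs_{i,j}| it is a suffix of the lrs of T[i..j].
module Submission where

open import Defs
open import Data.Nat using (ℕ; suc; _+_; _∸_; _≤_; _<_)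
open import Data.Sum using (_⊎_)
open import Relation.Binary.PropositionalEquality using (_≡_)
open import Function.Bundles using (_⇔_)

open import Data.Nat using (zero; s≤s; _≟_)
open import Data.Nat.Properties
open import Data.Product using (Σ; _×_; _,_)
open import Data.Sum using (inj₁; inj₂)
open import Function using (_∘_)
open import Function.Bundles using (mk⇔)
open import Function.Construct.Composition using (_⇔-∘_)
open import Relation.Nullary using (¬_; yes; no; contradiction)
open import Relation.Binary.PropositionalEquality
  using (refl; sym; trans; cong; subst; subst₂; _≢_; module ≡-Reasoning)

[m∸n]+[n∸o]≡m∸o : ∀ {m n o} → o ≤ n → n ≤ m → (m ∸ n) + (n ∸ o) ≡ m ∸ o
[m∸n]+[n∸o]≡m∸o {m} {n} {o} o≤n n≤m = +-cancelʳ-≡ o _ _ (begin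
  (m ∸ n) + (n ∸ o) + o  ≡⟨ +-assoc (m ∸ n) (n ∸ o) o ⟩
  (m ∸ n) + (n ∸ o + o)  ≡⟨ cong ((m ∸ n) +_) (m∸n+n≡m o≤n) ⟩
  (m ∸ n) + n            ≡⟨ m∸n+n≡m n≤m ⟩
  m                      ≡⟨ m∸n+n≡m (≤-trans o≤n n≤m) ⟨
  (m ∸ o) + o            ∎)
  where open ≡-Reasoning

m+n≤o⇒n≤o∸m : ∀ m {n o} → m + n ≤ o → n ≤ o ∸ m
m+n≤o⇒n≤o∸m m {n} {o} le = m+n≤o⇒m≤o∸n n (subst (_≤ o) (+-comm m n) le)

module _ {A : Set} (T : ℕ → A) where

  Run : (s ℓ : ℕ) → A → Set
  Run s ℓ α = (q : ℕ) → q ≤ ℓ → T (s + q) ≡ α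

  Run-last : ∀ {s ℓ α} → Run s ℓ α → T (s + ℓ) ≡ α
  Run-last run = run _ ≤-refl

  shift-invariant⇒Run : ∀ {s ℓ} → ((q : ℕ) → q < ℓ → T (suc s + q) ≡ T (s + q))
    → Run s ℓ (T s)
  shift-invariant⇒Run {s} shift zero    _   = cong T (+-identityʳ s)
  shift-invariant⇒Run {s} shift (suc q) q<ℓ = begin
    T (s + suc q)  ≡⟨ cong T (+-suc s q) ⟩
    T (suc s + q)  ≡⟨ shift q q<ℓ ⟩
    T (s + q)      ≡⟨ shift-invariant⇒Run shift q (<⇒≤ q<ℓ) ⟩
    T s            ∎
    where open ≡-Reasoning

  Run⇒shift-invariant : ∀ {s ℓ α} → Run s ℓ α
    → (q : ℕ) → q < ℓ → T (suc s + q) ≡ T (s + q)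
  Run⇒shift-invariant {s} run q q<ℓ =
    trans (cong T (sym (+-suc s q))) (trans (run (suc q) q<ℓ) (sym (run q (<⇒≤ q<ℓ))))

  OccursAt-self : ∀ {i e s ℓ} → i ≤ s → s + ℓ ≤ suc e → OccursAt T i e s ℓ s
  OccursAt-self i≤s end = i≤s , end , λ _ _ → refl

  OccursAt-extend : ∀ {i e s ℓ p} → OccursAt T i e s ℓ p → OccursAt T i (suc e) s ℓ p
  OccursAt-extend (i≤p , end , eq) = i≤p , ≤-trans end (n≤1+n _) , eq

  OccursAt-shrink : ∀ {i e s ℓ p} → p + ℓ ≢ suc (suc e)
    → OccursAt T i (suc e) s ℓ p → OccursAt T i e s ℓ p
  OccursAt-shrink ≢end (i≤p , end , eq) = i≤p , ≤-pred (≤∧≢⇒< end ≢end) , eq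

  OccursAt-suffix : ∀ {i e s p} d ℓ → OccursAt T i e s (d + ℓ) p
    → OccursAt T i e (s + d) ℓ (p + d)
  OccursAt-suffix {e = e} {s} {p} d ℓ (i≤p , end , eq) =
    ≤-trans i≤p (m≤m+n p d) ,
    subst (_≤ suc e) (sym (+-assoc p d ℓ)) end ,
    λ q q<ℓ → begin
      T (p + d + q)    ≡⟨ cong T (+-assoc p d q) ⟩
      T (p + (d + q))  ≡⟨ eq (d + q) (+-monoʳ-< d q<ℓ) ⟩
      T (s + (d + q))  ≡⟨ cong T (+-assoc s d q) ⟨
      T (s + d + q)    ∎
    where open ≡-Reasoning

  Repeating⇒late-occurrence : ∀ {i e s ℓ} → Repeating T i e s ℓ
    → Σ ℕ λ p → i < p × OccursAt T i e s ℓ p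
  Repeating⇒late-occurrence {i} (p , p′ , p≢p′ , occ@(i≤p , _) , occ′@(i≤p′ , _)) with p ≟ i
  ... | yes refl = p′ , ≤∧≢⇒< i≤p′ p≢p′ , occ′
  ... | no p≢i   = p , ≤∧≢⇒< i≤p (p≢i ∘ sym) , occ

  Repeating⇒+≤ : ∀ {i e s ℓ} → Repeating T i e s ℓ → ℓ + i ≤ e
  Repeating⇒+≤ {i} {e} {ℓ = ℓ} rep with Repeating⇒late-occurrence rep
  ... | p , i<p , (_ , end , _) = ≤-pred (begin
    suc (ℓ + i)  ≡⟨ +-suc ℓ i ⟨
    ℓ + suc i    ≤⟨ +-monoʳ-≤ ℓ i<p ⟩
    ℓ + p        ≡⟨ +-comm ℓ p ⟩
    p + ℓ        ≤⟨ end ⟩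
    suc e        ∎)
    where open ≤-Reasoning

  Repeating-suffix : ∀ {i e s} d ℓ → Repeating T i e s (d + ℓ) → Repeating T i e (s + d) ℓ
  Repeating-suffix d ℓ (p , p′ , p≢p′ , occ , occ′) =
    p + d , p′ + d , p≢p′ ∘ +-cancelʳ-≡ d p p′ ,
    OccursAt-suffix d ℓ occ , OccursAt-suffix d ℓ occ′

  Repeating-extend : ∀ {i e s ℓ} → Repeating T i e s ℓ → Repeating T i (suc e) s ℓ
  Repeating-extend (p , p′ , p≢p′ , occ , occ′) =
    p , p′ , p≢p′ , OccursAt-extend occ , OccursAt-extend occ′

  Run⇒Repeating : ∀ {i e s ℓ α} → i ≤ s → suc s + ℓ ≤ suc e → Run s ℓ α
    → Repeating T i e s ℓ
  Run⇒Repeating i≤s end run =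
    _ , _ , 1+n≢n ∘ sym ,
    OccursAt-self i≤s (m≤n⇒m≤1+n (≤-pred end)) ,
    (≤-trans i≤s (n≤1+n _) , end , Run⇒shift-invariant run)

  Repeating-suc⇒Repeating⊎suffix : ∀ {i e s ℓ} → Repeating T i (suc e) s ℓ
    → Repeating T i e s ℓ ⊎ (Σ ℕ λ p → p + ℓ ≡ suc (suc e) × OccursAt T i (suc e) s ℓ p)
  Repeating-suc⇒Repeating⊎suffix {e = e} {ℓ = ℓ} (p , p′ , p≢p′ , occ , occ′)
    with p + ℓ ≟ suc (suc e) | p′ + ℓ ≟ suc (suc e)
  ... | yes end | _        = inj₂ (p , end , occ)
  ... | no _    | yes end′ = inj₂ (p′ , end′ , occ′)
  ... | no ≢end | no ≢end′ =
    inj₁ (p , p′ , p≢p′ , OccursAt-shrink ≢end occ , OccursAt-shrink ≢end′ occ′)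

  ¬Repeating⇒Unique : ∀ {i e s ℓ} → OccursAt T i e s ℓ s → ¬ Repeating T i e s ℓ
    → Unique T i e s ℓ
  ¬Repeating⇒Unique {s = s} occ ¬rep = s , occ , only-s
    where
    only-s : ∀ p → OccursAt T _ _ s _ p → p ≡ s
    only-s p occₚ with p ≟ s
    ... | yes p≡s = p≡s
    ... | no p≢s  = contradiction (p , s , p≢s , occₚ , occ) ¬rep

  IsLrsLength⇒+≤ : ∀ {i e k} → IsLrsLength T i e k → k + i ≤ e
  IsLrsLength⇒+≤ (_ , rep , _) = Repeating⇒+≤ rep

  InMUS-lrs-extension⇔Repeating : ∀ {i e k} → IsLrsLength T i e k
    → InMUS T i e (e ∸ k) e ⇔ Repeating T i e (e ∸ k) k
  InMUS-lrs-extension⇔Repeating {i} {e} {k} lrs@(_ , rep , maximal) = mk⇔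
    (λ (_ , _ , _ , _ , _ , rep′) → subst (Repeating T i e s) e∸s≡k rep′)
    (λ rep′ → i≤s , m∸n≤m e k , ≤-refl , unique , rep-lrs ,
              subst (Repeating T i e s) (sym e∸s≡k) rep′)
    where
    s : ℕ
    s = e ∸ k
    k+i≤e : k + i ≤ e
    k+i≤e = IsLrsLength⇒+≤ lrs
    k≤e : k ≤ e
    k≤e = m+n≤o⇒m≤o k k+i≤e
    i≤s : i ≤ s
    i≤s = m+n≤o⇒n≤o∸m k k+i≤e
    e∸s≡k : e ∸ s ≡ k
    e∸s≡k = m∸[m∸n]≡n k≤e
    rep-lrs : Repeating T i e (suc s) (e ∸ s)
    rep-lrs = subst₂ (Repeating T i e) (+-∸-assoc 1 k≤e) (sym e∸s≡k) rep
    -- suc e ∸ suc k reduces to s, so maximality of k applies to T[s..e]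
    ¬rep-longer : ¬ Repeating T i e s (suc k)
    ¬rep-longer rep″ = 1+n≰n (maximal (suc k) (m+n≤o⇒m≤o∸n (suc k) (s≤s k+i≤e)) rep″)
    unique : Unique T i e s (suc e ∸ s)
    unique = subst (Unique T i e s)
      (sym (trans (+-∸-assoc 1 (m∸n≤m e k)) (cong suc e∸s≡k)))
      (¬Repeating⇒Unique
        (OccursAt-self i≤s (≤-reflexive (trans (+-suc s k) (cong suc (m∸n+n≡m k≤e)))))
        ¬rep-longer)

  Repeating-after-lrs⇔ : ∀ {i e k k₀} → IsLrsLength T i e k₀ → k + i ≤ suc e
    → Repeating T i (suc e) (suc e ∸ k) k ⇔ (Run (suc e ∸ k) k (T (suc e)) ⊎ k ≤ k₀)
  Repeating-after-lrs⇔ {i} {e} {k} {k₀} (k₀≤ , rep₀ , maximal) k+i≤ = mk⇔ to from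
    where
    s : ℕ
    s = suc e ∸ k
    k≤ : k ≤ suc e
    k≤ = m+n≤o⇒m≤o k k+i≤
    s+k≡ : s + k ≡ suc e
    s+k≡ = m∸n+n≡m k≤
    i≤s : i ≤ s
    i≤s = m+n≤o⇒n≤o∸m k k+i≤

    suffix⇒Run : ∀ p → p + k ≡ suc (suc e) → OccursAt T i (suc e) s k p
      → Run s k (T (suc e))
    suffix⇒Run p end (_ , _ , shift) =
      subst (Run s k) (trans (sym (Run-last run)) (cong T s+k≡)) run
      where
      p≡suc-s : p ≡ suc s
      p≡suc-s = +-cancelʳ-≡ k p (suc s) (trans end (cong suc (sym s+k≡)))
      run : Run s k (T s)
      run = shift-invariant⇒Run
        (subst (λ x → ∀ q → q < k → T (x + q) ≡ T (s + q)) p≡suc-s shift)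

    to : Repeating T i (suc e) s k → Run s k (T (suc e)) ⊎ k ≤ k₀
    to rep with Repeating-suc⇒Repeating⊎suffix rep
    ... | inj₁ rep-e            = inj₂ (maximal k (m+n≤o⇒m≤o∸n k k+i≤) rep-e)
    ... | inj₂ (p , end , occ) = inj₁ (suffix⇒Run p end occ)

    from : Run s k (T (suc e)) ⊎ k ≤ k₀ → Repeating T i (suc e) s k
    from (inj₁ run)  = Run⇒Repeating i≤s (≤-reflexive (cong suc s+k≡)) run
    from (inj₂ k≤k₀) = Repeating-extend
      (subst (λ x → Repeating T i e x k)
        ([m∸n]+[n∸o]≡m∸o k≤k₀ (≤-trans k₀≤ (m∸n≤m (suc e) i)))
        (Repeating-suffix (k₀ ∸ k) k
          (subst (Repeating T i e (suc e ∸ k₀)) (sym (m∸n+n≡m k≤k₀)) rep₀)))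

lemma4 : {A : Set} (n : ℕ) (T : ℕ → A) (i j : ℕ)
    → 1 ≤ i → i ≤ j → j < n
    → (k : ℕ) → IsLrsLength T i (suc j) k
    → (k₀ : ℕ) → IsLrsLength T i j k₀
    → InMUS T i (suc j) (suc j ∸ k) (suc j)
      ⇔ (((q : ℕ) → q ≤ k → T ((suc j ∸ k) + q) ≡ T (suc j)) ⊎ k ≤ k₀)
lemma4 n T i j _ _ _ k lrs k₀ lrs₀ =
  Repeating-after-lrs⇔ T lrs₀ (IsLrsLength⇒+≤ T lrs) ⇔-∘ InMUS-lrs-extension⇔Repeating T lrs
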